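{- With the notation of the context: (i) For every $\alpha\in\mathbb{F}_q$, $N_\alpha$ is symmetric. (ii) For all $\alpha,\beta\in\mathbb{F}_q$, $$N_{\alpha} N_{\beta}= q^2 I_{q(q+2)}\otimes \phi(\alpha+\beta)+q\, I_{q+2}\otimes \phi(\alpha+\beta)\otimes J_q+q\, (J_{q(q+2)}-I_{q(q+2)})\otimes J_{q}.$$ In particular $N_{\alpha}^2=q^2 I_{(q+2)q^2}+q J_{(q+2)q^2}$, that is, $N_\alpha$ is the incidence matrix of a symmetric $((q+2)q^2,\,q^2+q,\,q)$-design.
   Context: Let $m\ge1$, $q=2^m$, $\mathbb{F}_q$ the field with $q$ elements. Fix an $\mathbb{F}_2$-linear identification of $(\mathbb{F}_q,+)$ with $\mathbb{F}_2^m$. All matrices are indexed by finite sets; for $A$ indexed by $X$ and $B$ by $Y$, $A\otimes B$ is indexed by $X\times Y$ with $((u,v),(u',v'))$-entry $A_{u,u'}B_{v,v'}$. $I_q,J_q$ (identity, all-ones) are indexed by $\mathbb{F}_q$; $O_{q^2}$ (zero) by $\mathbb{F}_q\times\mathbb{F}_q$. For $\alpha\in\mathbb{F}_q$, $\phi(\alpha)$ is the permutation matrix indexed by $\mathbb{F}_q$ with $(\gamma,\gamma')$-entry $1$ iff $\gamma+\gamma'=\alpha$ (equivalently $\otimes_{i=1}^m R^{\alpha_i}$, $R=J_2-I_2$). For $\alpha,\alpha'\in\mathbb{F}_q$, $C_{\alpha,\alpha'}$ is the matrix indexed by $\mathbb{F}_q\times\mathbb{F}_q$ with $((\beta,\gamma),(\beta',\gamma'))$-entry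 equal to the $(\gamma,\gamma')$-entry of $\phi(\alpha(-\beta+\beta')+\alpha')$. For new symbols $x,y$: $C_{x,\alpha}=O_{q^2}$, $C_{y,\alpha}=\phi(\alpha)\otimes J_q$. Let $S=\mathbb{F}_q\cup\{x,y\}$ and $L$ a symmetric Latin square with rows, columns and symbols indexed by $S$ and $L(a,a)=x$ for all $a$. For $a\in S$, $P_a$ is the matrix indexed by $S$ with $(b,b')$-entry $1$ iff $L(b,b')=a$; $I_{q+2}$ is indexed by $S$; $I_{q(q+2)},J_{q(q+2)}$ by $S\times\mathbb{F}_q$; $I_{(q+2)q^2},J_{(q+2)q^2}$ by $S\times\mathbb{F}_q\times\mathbb{F}_q$. For $\alpha\in\mathbb{F}_q$, $N_\alpha=\sum_{a\in\mathbb{F}_q\cup\{y\}}P_a\otimes C_{a,\alpha}$ (block matrix with $(a,a')$-block $C_{L(a,a'),\alpha}$). A symmetric $(v,k,\lambda)$-design has a $v\times v$ $(0,1)$ incidence matrix $N$ with $NN^\top=(k-\lambda)I+\lambda J$ and constant row sums $k$. -}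

module Defs where

open import Level using (0ℓ)
open import Data.Nat as ℕ using (ℕ; zero; suc; _∸_; _^_)
open import Data.List using (List; []; _∷_; map; length; concatMap; foldr)
open import Data.List.Membership.Propositional using (_∈_)
open import Data.List.Relation.Unary.Unique.Propositional using (Unique)
open import Data.Product using (Σ; ∃; _×_; _,_)
open import Data.Bool using (if_then_else_)
open import Relation.Nullary using (¬_; Dec; yes; no)
open import Relation.Nullary.Decidable using (⌊_⌋)
open import Relation.Binary.PropositionalEquality using (_≡_; _≢_)
open import Relation.Binary.Definitions using (DecidableEquality)
open import Algebra.Structures using (IsCommutativeRing)

record FiniteField (m : ℕ) : Set₁ where
  field
    F      : Set
    _+_    : F → F → F
    _*_    : F → F → F
    -_     : F → F
    0#     : F
    1#     : F
    isCommutativeRing : IsCommutativeRing _≡_ _+_ _*_ -_ 0# 1#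
    0≢1    : 0# ≢ 1#
    inverse : ∀ a → a ≢ 0# → Σ F (λ b → a * b ≡ 1#)
    _≟_    : DecidableEquality F
    elems  : List F
    complete : ∀ a → a ∈ elems
    unique   : Unique elems
    card     : length elems ≡ 2 ^ m

sumL : {A : Set} → List A → (A → ℕ) → ℕ
sumL xs f = foldr (λ a s → f a ℕ.+ s) 0 xs

Mat : Set → Set
Mat X = X → X → ℕ

_⊗_ : {X Y : Set} → Mat X → Mat Y → Mat (X × Y)
(A ⊗ B) (u , v) (u' , v') = A u u' ℕ.* B v v'
infixr 7 _⊗_

_⊕_ : {X : Set} → Mat X → Mat X → Mat X
(A ⊕ B) i j = A i j ℕ.+ B i j
infixl 6 _⊕_

-- entrywise difference (only used as J - I, where it is exact)
_⊖_ : {X : Set} → Mat X → Mat X → Mat X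
(A ⊖ B) i j = A i j ∸ B i j

_·_ : {X : Set} → ℕ → Mat X → Mat X
(c · A) i j = c ℕ.* A i j
infixr 8 _·_

transpose : {X : Set} → Mat X → Mat X
transpose A i j = A j i

mul : {X : Set} → List X → Mat X → Mat X → Mat X
mul xs A B i j = sumL xs (λ k → A i k ℕ.* B k j)

matSum : {X A : Set} → List A → (A → Mat X) → Mat X
matSum as f i j = sumL as (λ a → f a i j)

Idm : {X : Set} → DecidableEquality X → Mat X
Idm _≟X_ i j = if ⌊ i ≟X j ⌋ then 1 else 0

Jm : {X : Set} → Mat X
Jm _ _ = 1

Om : {X : Set} → Mat X
Om _ _ = 0

_≐_ : {X : Set} → Mat X → Mat X → Set
A ≐ B = ∀ i j → A i j ≡ B i j
infix 4 _≐_

reassoc : {A B C : Set} → Mat ((A × B) × C) → Mat (A × (B × C))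
reassoc M (a , b , c) (a' , b' , c') = M ((a , b) , c) ((a' , b') , c')

IsSymmetricDesign : {X : Set} → List X → DecidableEquality X →
                    ℕ → ℕ → ℕ → Mat X → Set
IsSymmetricDesign {X} xs _≟X_ v k λ' N =
  (length xs ≡ v)
  × (∀ i j → (N i j ≡ 0) Data.Sum.⊎ (N i j ≡ 1))
  × (∀ i → sumL xs (N i) ≡ k)
  × (mul xs N (transpose N) ≐ ((k ∸ λ') · Idm _≟X_) ⊕ (λ' · Jm))
  where import Data.Sum

data Sym (F : Set) : Set where
  el : F → Sym F
  x  : Sym F
  y  : Sym F

record SymLatin (F : Set) : Set where
  field
    L : Sym F → Sym F → Sym F
    row-unique : ∀ a s → Σ (Sym F) (λ b → L a b ≡ s × (∀ b' → L a b' ≡ s → b' ≡ b))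
    col-unique : ∀ b s → Σ (Sym F) (λ a → L a b ≡ s × (∀ a' → L a' b ≡ s → a' ≡ a))
    symmetric  : ∀ a b → L a b ≡ L b a
    diagonal   : ∀ a → L a a ≡ x

module Construction {m : ℕ} (𝔽 : FiniteField m) (Lat : SymLatin (FiniteField.F 𝔽)) where
  open FiniteField 𝔽
  open SymLatin Lat

  q : ℕ
  q = 2 ^ m

  S : Set
  S = Sym F

  _≟S_ : DecidableEquality S
  el a ≟S el b with a ≟ b
  ... | yes Relation.Binary.PropositionalEquality.refl = yes Relation.Binary.PropositionalEquality.refl
  ... | no ne = no (λ { Relation.Binary.PropositionalEquality.refl → ne Relation.Binary.PropositionalEquality.refl })
  el _ ≟S x = no (λ ())
  el _ ≟S y = no (λ ())
  x ≟S el _ = no (λ ())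
  x ≟S x = yes Relation.Binary.PropositionalEquality.refl
  x ≟S y = no (λ ())
  y ≟S el _ = no (λ ())
  y ≟S x = no (λ ())
  y ≟S y = yes Relation.Binary.PropositionalEquality.refl

  _≟F²_ : DecidableEquality (F × F)
  _≟F²_ = Data.Product.Properties.≡-dec _≟_ _≟_
    where import Data.Product.Properties

  _≟SF_ : DecidableEquality (S × F)
  _≟SF_ = Data.Product.Properties.≡-dec _≟S_ _≟_
    where import Data.Product.Properties

  _≟SFF_ : DecidableEquality (S × (F × F))
  _≟SFF_ = Data.Product.Properties.≡-dec _≟S_ _≟F²_
    where import Data.Product.Properties

  elemsS : List S
  elemsS = x ∷ y ∷ map el elems

  pairs : {A B : Set} → List A → List B → List (A × B)
  pairs as bs = concatMap (λ a → map (a ,_) bs) as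

  elemsSFF : List (S × (F × F))
  elemsSFF = pairs elemsS (pairs elems elems)

  φ : F → Mat F
  φ α γ γ' = if ⌊ (γ + γ') ≟ α ⌋ then 1 else 0

  C : S → F → Mat (F × F)
  C (el a) α' (β , γ) (β' , γ') = φ ((a * ((- β) + β')) + α') γ γ'
  C x α = Om
  C y α = φ α ⊗ Jm

  P : S → Mat S
  P a b b' = if ⌊ L b b' ≟S a ⌋ then 1 else 0

  N : F → Mat (S × (F × F))
  N α = matSum (y ∷ map el elems) (λ a → P a ⊗ C a α)

-- In characteristic 2, which |𝔽| = 2^m with m ≥ 1 forces, every block C_{s,α} is the indicator
-- of an affine condition, so each block product C_{s,α} C_{t,β} counts the roots of an affine
-- equation: it is 0 if s or t is x, J for other distinct s, t, and q times an indicator if s = t.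
-- The (a, a') block of N_α N_β is Σ_c C_{L(a,c),α} C_{L(c,a'),β}.  For a ≠ a' the Latin square
-- makes L(a,c) and L(c,a') distinct and different from x except at c ∈ {a, a'}, giving q J; for
-- a = a' the symmetry of L and a reindexing along row a turn the sum into Σ_s C_{s,α} C_{s,β}.

module Submission where

open import Level using (0ℓ)
open import Function using (_∘_)
open import Data.Nat using (ℕ; suc; _+_; _*_; _^_; _∸_; _≤_; _≥_; s≤s; z≤n)
open import Data.Nat.Properties hiding (_≟_)
open import Data.Nat.Tactic.RingSolver using (solve-∀)
open import Data.Product using (_×_; _,_; proj₁; proj₂; ∃-syntax)
open import Data.Product.Properties using (≡-dec)
open import Data.Empty using (⊥-elim)
open import Data.Sum using (_⊎_; inj₁; inj₂)
open import Data.List using (List; []; _∷_; map; length; concatMap; _++_)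
open import Data.List.Properties using (length-map)
open import Data.List.Membership.Propositional using (_∈_)
open import Data.List.Membership.Propositional.Properties using (∈-map⁺)
open import Data.List.Relation.Unary.Any using (here; there)
open import Data.List.Relation.Unary.All as All using (All; []; _∷_)
open import Data.List.Relation.Unary.All.Properties using () renaming (map⁺ to All-map⁺)
open import Data.List.Relation.Unary.AllPairs as AllPairs using (_∷_)
open import Data.List.Relation.Unary.Unique.Propositional using (Unique)
open import Data.List.Relation.Unary.Unique.Propositional.Properties using () renaming (map⁺ to Unique-map⁺)
open import Data.Bool using (Bool; true; false; if_then_else_)
open import Relation.Nullary using (Dec; yes; no; contradiction)
open import Relation.Binary.Definitions using (DecidableEquality)
open import Relation.Binary.PropositionalEquality
open import Algebra.Bundles using (CommutativeRing)
open import Algebra.Structures using (IsCommutativeRing)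
import Algebra.Properties.Ring
open import Data.Maybe using (nothing)
open import Tactic.RingSolver.Core.AlmostCommutativeRing using (fromCommutativeRing)
import Tactic.RingSolver.NonReflective
open import Defs

module _ {A : Set} where

  sumL-cong : (xs : List A) {f g : A → ℕ} → (∀ a → f a ≡ g a) → sumL xs f ≡ sumL xs g
  sumL-cong []       f≗g = refl
  sumL-cong (a ∷ xs) f≗g = cong₂ _+_ (f≗g a) (sumL-cong xs f≗g)

  sumL-+ : (xs : List A) (f g : A → ℕ) → sumL xs (λ a → f a + g a) ≡ sumL xs f + sumL xs g
  sumL-+ []       f g = refl
  sumL-+ (a ∷ xs) f g rewrite sumL-+ xs f g = +-comm-middle (f a) (g a) (sumL xs f) (sumL xs g)
    where
    +-comm-middle : ∀ u v s t → u + v + (s + t) ≡ u + s + (v + t)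
    +-comm-middle = solve-∀

  sumL-*ˡ : (xs : List A) (c : ℕ) (f : A → ℕ) → sumL xs (λ a → c * f a) ≡ c * sumL xs f
  sumL-*ˡ []       c f = sym (*-zeroʳ c)
  sumL-*ˡ (a ∷ xs) c f rewrite sumL-*ˡ xs c f = sym (*-distribˡ-+ c (f a) _)

  sumL-const : (xs : List A) (c : ℕ) → sumL xs (λ _ → c) ≡ length xs * c
  sumL-const []       c = refl
  sumL-const (a ∷ xs) c = cong (c +_) (sumL-const xs c)

  sumL-zero : {xs : List A} {f : A → ℕ} → All (λ a → f a ≡ 0) xs → sumL xs f ≡ 0
  sumL-zero []         = refl
  sumL-zero (fa≡0 ∷ p) = cong₂ _+_ fa≡0 (sumL-zero p)

  sumL-++ : (xs ys : List A) (f : A → ℕ) → sumL (xs ++ ys) f ≡ sumL xs f + sumL ys f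
  sumL-++ []       ys f = refl
  sumL-++ (a ∷ xs) ys f rewrite sumL-++ xs ys f = sym (+-assoc (f a) _ _)

  sumL-delta : {xs : List A} → Unique xs → {c : A} → c ∈ xs → (f : A → ℕ) →
               (∀ b → b ≢ c → f b ≡ 0) → sumL xs f ≡ f c
  sumL-delta (c∉xs ∷ _) (here refl) f f≡0 =
    trans (cong (f _ +_) (sumL-zero (All.map (λ c≢b → f≡0 _ (c≢b ∘ sym)) c∉xs))) (+-identityʳ _)
  sumL-delta {b ∷ xs} (b∉xs ∷ u) (there c∈xs) f f≡0 =
    trans (cong (_+ sumL xs f) (f≡0 b (λ b≡c → All.lookup b∉xs c∈xs b≡c))) (sumL-delta u c∈xs f f≡0)

  Idm-refl : (d : DecidableEquality A) (i : A) → Idm d i i ≡ 1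
  Idm-refl d i with d i i
  ... | yes _   = refl
  ... | no i≢i = contradiction refl i≢i

  Idm-≢ : (d : DecidableEquality A) {i j : A} → i ≢ j → Idm d i j ≡ 0
  Idm-≢ d {i} {j} i≢j with d i j
  ... | yes i≡j = contradiction i≡j i≢j
  ... | no _    = refl

  sumL-pick : {xs : List A} → Unique xs → {c : A} → c ∈ xs →
              (d : DecidableEquality A) (g : A → ℕ) → sumL xs (λ b → Idm d c b * g b) ≡ g c
  sumL-pick u c∈xs d g =
    trans (sumL-delta u c∈xs _ (λ b b≢c → cong (_* g b) (Idm-≢ d (b≢c ∘ sym))))
          (trans (cong (_* g _) (Idm-refl d _)) (+-identityʳ _))

  sumL-symmetric : (xs : List A) (R : A → A → ℕ) → (∀ a b → R a b ≡ R b a) →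
                   ∃[ k ] sumL xs (λ a → sumL xs (R a)) ≡ sumL xs (λ a → R a a) + 2 * k
  sumL-symmetric []       R R-sym = 0 , refl
  sumL-symmetric (c ∷ xs) R R-sym with sumL-symmetric xs R R-sym
  ... | k , rest = T + k , (begin
    R c c + T + sumL xs (λ a → R a c + sumL xs (R a))
      ≡⟨ cong (R c c + T +_) (trans (sumL-+ xs _ _) (cong₂ _+_ (sumL-cong xs (λ a → R-sym a c)) rest)) ⟩
    R c c + T + (T + (D + 2 * k))
      ≡⟨ regroup (R c c) T D k ⟩
    R c c + D + 2 * (T + k) ∎)
    where
    open ≡-Reasoning
    T = sumL xs (R c)
    D = sumL xs (λ a → R a a)
    regroup : ∀ r t d k → r + t + (t + (d + 2 * k)) ≡ r + d + 2 * (t + k)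
    regroup = solve-∀

sumL-map : {A B : Set} (xs : List A) (g : A → B) (f : B → ℕ) → sumL (map g xs) f ≡ sumL xs (f ∘ g)
sumL-map []       g f = refl
sumL-map (a ∷ xs) g f = cong (f (g a) +_) (sumL-map xs g f)

module _ {A B : Set} where

  sumL-concatMap-pairs : (as : List A) (bs : List B) (f : A × B → ℕ) →
    sumL (concatMap (λ a → map (a ,_) bs) as) f ≡ sumL as (λ a → sumL bs (λ b → f (a , b)))
  sumL-concatMap-pairs []       bs f = refl
  sumL-concatMap-pairs (a ∷ as) bs f =
    trans (sumL-++ (map (a ,_) bs) _ f)
          (cong₂ _+_ (sumL-map bs (a ,_) f) (sumL-concatMap-pairs as bs f))

  sumL-swap : (as : List A) (bs : List B) (f : A → B → ℕ) →
    sumL as (λ a → sumL bs (f a)) ≡ sumL bs (λ b → sumL as (λ a → f a b))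
  sumL-swap []       bs f = sym (sumL-zero (All.universal (λ _ → refl) bs))
  sumL-swap (a ∷ as) bs f = trans (cong (sumL bs (f a) +_) (sumL-swap as bs f)) (sym (sumL-+ bs (f a) _))

  Idm-pair : (d₁ : DecidableEquality A) (d₂ : DecidableEquality B) (i i' : A) (j j' : B) →
             Idm (≡-dec d₁ d₂) (i , j) (i' , j') ≡ Idm d₁ i i' * Idm d₂ j j'
  Idm-pair d₁ d₂ i i' j j' with d₁ i i'
  ... | no  i≢i' = refl
  ... | yes refl with d₂ j j'
  ...   | no  j≢j' = refl
  ...   | yes refl = refl

indicator-01 : (b : Bool) → (if b then 1 else 0) ≡ 0 ⊎ (if b then 1 else 0) ≡ 1
indicator-01 false = inj₁ refl
indicator-01 true  = inj₂ refl

Idm-≤1 : {X : Set} (d : DecidableEquality X) (i j : X) → Idm d i j ≤ 1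
Idm-≤1 d i j with d i j
... | yes _ = s≤s z≤n
... | no  _ = z≤n

*-complement : ∀ c {i} → i ≤ 1 → c * i + c * (1 ∸ i) ≡ c * 1
*-complement c {i} i≤1 = trans (sym (*-distribˡ-+ c i (1 ∸ i))) (cong (c *_) (m+[n∸m]≡n i≤1))

2^-even : ∀ n → n ≥ 1 → 2 ^ n ≡ 2 * 2 ^ (n ∸ 1)
2^-even (suc n) _ = refl

module FieldLemmas {m : ℕ} (𝔽 : FiniteField m) where
  open FiniteField 𝔽 renaming (_+_ to infixl 6 _+F_; _*_ to infixl 7 _*F_; -_ to infix 8 -F_)
  module R = IsCommutativeRing isCommutativeRing

  commutativeRing : CommutativeRing 0ℓ 0ℓ
  commutativeRing = record { isCommutativeRing = isCommutativeRing }

  open Algebra.Properties.Ring (CommutativeRing.ring commutativeRing) public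
    using (+-inverseˡ-unique)
  open Tactic.RingSolver.NonReflective (fromCommutativeRing commutativeRing (λ _ → nothing)) public
    using (solve; _⊜_) renaming (_⊕_ to infixl 6 _:+_; _⊗_ to infixl 7 _:*_)

  δ₀ : F → ℕ
  δ₀ z = Idm _≟_ z 0#

  δ₀-≡0 : ∀ {z} → z ≡ 0# → δ₀ z ≡ 1
  δ₀-≡0 refl = Idm-refl _≟_ 0#

  δ₀-≢0 : ∀ {z} → z ≢ 0# → δ₀ z ≡ 0
  δ₀-≢0 = Idm-≢ _≟_

  ΣF : (F → ℕ) → ℕ
  ΣF = sumL elems

  ΣF-delta : ∀ c (f : F → ℕ) → (∀ b → b ≢ c → f b ≡ 0) → ΣF f ≡ f c
  ΣF-delta c = sumL-delta unique (complete c)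

  ΣF-const : ∀ k → ΣF (λ _ → k) ≡ 2 ^ m * k
  ΣF-const k = trans (sumL-const elems k) (cong (_* k) card)

  ΣF-zero : {f : F → ℕ} → (∀ a → f a ≡ 0) → ΣF f ≡ 0
  ΣF-zero f≡0 = sumL-zero (All.universal f≡0 elems)

  x+x≡2x : ∀ a → a +F a ≡ (1# +F 1#) *F a
  x+x≡2x a = begin
    a +F a               ≡⟨ cong₂ _+F_ (R.*-identityˡ a) (R.*-identityˡ a) ⟨
    1# *F a +F 1# *F a   ≡⟨ R.distribʳ a 1# 1# ⟨
    (1# +F 1#) *F a      ∎
    where open ≡-Reasoning

  module _ {d : F} (d≢0 : d ≢ 0#) where

    private
      d⁻¹ : F
      d⁻¹ = proj₁ (inverse d d≢0)

      d*d⁻¹≡1 : d *F d⁻¹ ≡ 1#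
      d*d⁻¹≡1 = proj₂ (inverse d d≢0)

    *-cancelˡ-nonzero : ∀ {a b} → d *F a ≡ d *F b → a ≡ b
    *-cancelˡ-nonzero {a} {b} da≡db = begin
      a                   ≡⟨ unscale a ⟨
      d⁻¹ *F (d *F a)     ≡⟨ cong (d⁻¹ *F_) da≡db ⟩
      d⁻¹ *F (d *F b)     ≡⟨ unscale b ⟩
      b                   ∎
      where
      open ≡-Reasoning
      unscale : ∀ a → d⁻¹ *F (d *F a) ≡ a
      unscale a = begin
        d⁻¹ *F (d *F a)   ≡⟨ R.*-assoc d⁻¹ d a ⟨
        d⁻¹ *F d *F a     ≡⟨ cong (_*F a) (trans (R.*-comm d⁻¹ d) d*d⁻¹≡1) ⟩
        1# *F a           ≡⟨ R.*-identityˡ a ⟩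
        a                 ∎

    ΣF-δ₀-linear : ∀ K → ΣF (λ b → δ₀ (d *F b +F K)) ≡ 1
    ΣF-δ₀-linear K = trans (ΣF-delta root _ off-root) (δ₀-≡0 at-root)
      where
      root = d⁻¹ *F (-F K)
      d*root : d *F root ≡ -F K
      d*root = trans (sym (R.*-assoc d d⁻¹ (-F K)))
                     (trans (cong (_*F -F K) d*d⁻¹≡1) (R.*-identityˡ (-F K)))
      at-root : d *F root +F K ≡ 0#
      at-root = trans (cong (_+F K) d*root) (R.-‿inverseˡ K)
      off-root : ∀ b → b ≢ root → δ₀ (d *F b +F K) ≡ 0
      off-root b b≢root = δ₀-≢0 (λ db+K≡0 →
        b≢root (*-cancelˡ-nonzero (trans (+-inverseˡ-unique (d *F b) K db+K≡0) (sym d*root))))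

  -- Each row of {(a, b) | a + b = 0} has one element, so it has 2^m elements; if 2 were
  -- invertible, (0, 0) would be the only point fixed by (a, b) ↦ (b, a), making the count odd.
  characteristic-two : m ≥ 1 → 1# +F 1# ≡ 0#
  characteristic-two m≥1 with (1# +F 1#) ≟ 0#
  ... | yes 2≡0 = 2≡0
  ... | no  2≢0 with sumL-symmetric elems (λ a b → δ₀ (a +F b)) (λ a b → cong δ₀ (R.+-comm a b))
  ...   | k , pairs≡diagonal+even = ⊥-elim (even≢odd (2 ^ (m ∸ 1)) k (begin
    2 * 2 ^ (m ∸ 1)                               ≡⟨ 2^-even m m≥1 ⟨
    2 ^ m                                         ≡⟨ trans (sumL-cong elems rows) (trans (ΣF-const 1) (*-identityʳ _)) ⟨
    ΣF (λ a → ΣF (λ b → δ₀ (a +F b)))             ≡⟨ pairs≡diagonal+even ⟩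
    ΣF (λ a → δ₀ (a +F a)) + 2 * k                ≡⟨ cong (_+ 2 * k) diagonal ⟩
    1 + 2 * k                                     ∎))
    where
    open ≡-Reasoning
    1≢0 : 1# ≢ 0#
    1≢0 = 0≢1 ∘ sym
    rows : ∀ a → ΣF (λ b → δ₀ (a +F b)) ≡ 1
    rows a = trans (sumL-cong elems (λ b → cong δ₀ (trans (R.+-comm a b) (cong (_+F a) (sym (R.*-identityˡ b))))))
                   (ΣF-δ₀-linear 1≢0 a)
    diagonal : ΣF (λ a → δ₀ (a +F a)) ≡ 1
    diagonal = trans (ΣF-delta 0# _ (λ a a≢0 → δ₀-≢0 (λ a+a≡0 →
                 a≢0 (*-cancelˡ-nonzero 2≢0 (trans (sym (x+x≡2x a)) (trans a+a≡0 (sym (R.zeroʳ _))))))))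
               (δ₀-≡0 (R.+-identityˡ 0#))

  module CharacteristicTwo (1+1≡0 : 1# +F 1# ≡ 0#) where

    x+x≡0 : ∀ a → a +F a ≡ 0#
    x+x≡0 a = trans (x+x≡2x a) (trans (cong (_*F a) 1+1≡0) (R.zeroˡ a))

    -x≡x : ∀ a → -F a ≡ a
    -x≡x a = sym (+-inverseˡ-unique a a (x+x≡0 a))

    +≡0⇒≡ : ∀ {a b} → a +F b ≡ 0# → a ≡ b
    +≡0⇒≡ {a} {b} a+b≡0 = trans (+-inverseˡ-unique a b a+b≡0) (-x≡x b)

    ΣF-δ₀-pick : ∀ c (h : F → ℕ) → ΣF (λ b → δ₀ (b +F c) * h b) ≡ h c
    ΣF-δ₀-pick c h =
      trans (ΣF-delta c _ (λ b b≢c → cong (_* h b) (δ₀-≢0 (b≢c ∘ +≡0⇒≡))))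
            (trans (cong (_* h c) (δ₀-≡0 (x+x≡0 c))) (+-identityʳ (h c)))

    ΣF-δ₀ : ∀ c → ΣF (λ b → δ₀ (b +F c)) ≡ 1
    ΣF-δ₀ c = trans (sumL-cong elems (λ b → sym (*-identityʳ _))) (ΣF-δ₀-pick c (λ _ → 1))

-- The diagonal entries of the product formula, with [β₁ = β₂] = 1 resp. 0 substituted.
product-diagonal-equal : ∀ n A B → n * A + n * (n * B) ≡ n * (n * 1) * (1 * B) + n * (1 * (A * 1)) + n * (0 * 1)
product-diagonal-equal = solve-∀

product-diagonal-distinct : ∀ n A B → n * A + n * 1 ≡ n * (n * 1) * (0 * B) + n * (1 * (A * 1)) + n * (1 * 1)
product-diagonal-distinct = solve-∀

module Design {m : ℕ} (m≥1 : m ≥ 1) (𝔽 : FiniteField m) (Lat : SymLatin (FiniteField.F 𝔽)) where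
  open FiniteField 𝔽 renaming (_+_ to infixl 6 _+F_; _*_ to infixl 7 _*F_; -_ to infix 8 -F_)
  open SymLatin Lat
  open Construction 𝔽 Lat
  open FieldLemmas 𝔽
  open CharacteristicTwo (characteristic-two m≥1)

  φ-δ₀ : ∀ α γ γ' → φ α γ γ' ≡ δ₀ (γ +F γ' +F α)
  φ-δ₀ α γ γ' with (γ +F γ') ≟ α
  ... | yes γ+γ'≡α = sym (δ₀-≡0 (trans (cong (_+F α) γ+γ'≡α) (x+x≡0 α)))
  ... | no  γ+γ'≢α = sym (δ₀-≢0 (γ+γ'≢α ∘ +≡0⇒≡))

  φ-sym : ∀ α γ γ' → φ α γ γ' ≡ φ α γ' γ
  φ-sym α γ γ' = trans (φ-δ₀ α γ γ') (trans (cong (λ z → δ₀ (z +F α)) (R.+-comm γ γ')) (sym (φ-δ₀ α γ' γ)))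

  φ-double : ∀ α γ γ' → φ (α +F α) γ γ' ≡ Idm _≟_ γ γ'
  φ-double α γ γ' with γ ≟ γ'
  ... | yes refl = trans (φ-δ₀ _ γ γ) (δ₀-≡0 (trans (cong (_+F (α +F α)) (x+x≡0 γ))
                                              (trans (R.+-identityˡ _) (x+x≡0 α))))
  ... | no  γ≢γ' = trans (φ-δ₀ _ γ γ') (δ₀-≢0 (λ e → γ≢γ' (+≡0⇒≡
          (trans (sym (R.+-identityʳ _)) (trans (cong (γ +F γ' +F_) (sym (x+x≡0 α))) e)))))

  C-el : ∀ u α β γ β' γ' → C (el u) α (β , γ) (β' , γ') ≡ δ₀ (γ +F γ' +F (u *F (β +F β') +F α))
  C-el u α β γ β' γ' = trans (cong (λ z → φ (u *F (z +F β') +F α) γ γ') (-x≡x β)) (φ-δ₀ _ γ γ')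

  C-el-row : ∀ u α β γ b g → C (el u) α (β , γ) (b , g) ≡ δ₀ (g +F (γ +F (u *F (β +F b) +F α)))
  C-el-row u α β γ b g = trans (C-el u α β γ b g) (cong δ₀ (swap γ g _))
    where
    swap : ∀ γ g e → γ +F g +F e ≡ g +F (γ +F e)
    swap = solve 3 (λ γ g e → (γ :+ g :+ e) ⊜ (g :+ (γ :+ e))) refl

  C-y-row : ∀ α β γ b g → C y α (β , γ) (b , g) ≡ δ₀ (b +F (β +F α))
  C-y-row α β γ b g = trans (*-identityʳ _) (trans (φ-δ₀ α β b) (cong δ₀ (swap β b α)))
    where
    swap : ∀ β b α → β +F b +F α ≡ b +F (β +F α)
    swap = solve 3 (λ β b α → (β :+ b :+ α) ⊜ (b :+ (β :+ α))) refl

  C-sym : ∀ s α p p' → C s α p' p ≡ C s α p p'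
  C-sym x      α p       p'        = refl
  C-sym y      α (β , γ) (β' , γ') = cong (_* 1) (φ-sym α β' β)
  C-sym (el u) α (β , γ) (β' , γ') =
    trans (C-el u α β' γ' β γ) (trans (cong δ₀ (swap γ' γ u β' β α)) (sym (C-el u α β γ β' γ')))
    where
    swap : ∀ γ' γ u β' β α → γ' +F γ +F (u *F (β' +F β) +F α) ≡ γ +F γ' +F (u *F (β +F β') +F α)
    swap = solve 6 (λ γ' γ u β' β α →
      (γ' :+ γ :+ (u :* (β' :+ β) :+ α)) ⊜ (γ :+ γ' :+ (u :* (β :+ β') :+ α))) refl

  C-01 : ∀ s α p p' → C s α p p' ≡ 0 ⊎ C s α p p' ≡ 1
  C-01 x      α p       p'        = inj₁ refl
  C-01 y      α (β , _) (β' , _) rewrite *-identityʳ (φ α β β') = indicator-01 _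
  C-01 (el _) α _       _         = indicator-01 _

  el-injective : ∀ {a b : F} → el a ≡ el b → a ≡ b
  el-injective refl = refl

  uniqueS : Unique elemsS
  uniqueS = ((λ ()) ∷ All-map⁺ (All.universal (λ _ ()) elems))
          AllPairs.∷ (All-map⁺ (All.universal (λ _ ()) elems) AllPairs.∷ Unique-map⁺ el-injective unique)

  completeS : ∀ s → s ∈ elemsS
  completeS x      = here refl
  completeS y      = there (here refl)
  completeS (el a) = there (there (∈-map⁺ el (complete a)))

  ΣS : (S → ℕ) → ℕ
  ΣS = sumL elemsS

  ΣS-delta : ∀ c (f : S → ℕ) → (∀ s → s ≢ c → f s ≡ 0) → ΣS f ≡ f c
  ΣS-delta c = sumL-delta uniqueS (completeS c)

  ΣS-pick : ∀ c (g : S → ℕ) → ΣS (λ s → Idm _≟S_ c s * g s) ≡ g c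
  ΣS-pick c = sumL-pick uniqueS (completeS c) _≟S_

  ΣS-Idm : ∀ a → ΣS (Idm _≟S_ a) ≡ 1
  ΣS-Idm a = trans (ΣS-delta a _ (λ c c≢a → Idm-≢ _≟S_ (c≢a ∘ sym))) (Idm-refl _≟S_ a)

  length-elemsS : length elemsS ≡ 2 + q
  length-elemsS = cong (2 +_) (trans (length-map el elems) card)

  ΣSFF : (f : S × (F × F) → ℕ) → sumL elemsSFF f ≡ ΣS (λ c → ΣF (λ b → ΣF (λ g → f (c , b , g))))
  ΣSFF f = trans (sumL-concatMap-pairs elemsS (pairs elems elems) f)
                 (sumL-cong elemsS (λ c → sumL-concatMap-pairs elems elems (λ bg → f (c , bg))))

  length-elemsSFF : length elemsSFF ≡ (q + 2) * q ^ 2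
  length-elemsSFF = begin
    length elemsSFF                               ≡⟨ *-identityʳ _ ⟨
    length elemsSFF * 1                           ≡⟨ sumL-const elemsSFF 1 ⟨
    sumL elemsSFF (λ _ → 1)                       ≡⟨ ΣSFF _ ⟩
    ΣS (λ _ → ΣF (λ _ → ΣF (λ _ → 1)))            ≡⟨ sumL-cong elemsS (λ _ → trans (sumL-cong elems (λ _ → ΣF-const 1)) (ΣF-const (q * 1))) ⟩
    ΣS (λ _ → q ^ 2)                              ≡⟨ sumL-const elemsS (q ^ 2) ⟩
    length elemsS * q ^ 2                         ≡⟨ cong (_* q ^ 2) (trans length-elemsS (+-comm 2 q)) ⟩
    (q + 2) * q ^ 2                               ∎
    where open ≡-Reasoning

  -- The x-summand of ΣS vanishes since C_x = O, so the block is picked out by P_{L(a,c)}.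
  N-block : ∀ α a p c p' → N α (a , p) (c , p') ≡ C (L a c) α p p'
  N-block α a p c p' = trans (cong (_+ N α (a , p) (c , p')) (sym (*-zeroʳ (P x a c))))
                             (ΣS-pick (L a c) (λ s → C s α p p'))

  N-symmetric : ∀ α → transpose (N α) ≐ N α
  N-symmetric α (a , p) (a' , p') = begin
    N α (a' , p') (a , p)    ≡⟨ N-block α a' p' a p ⟩
    C (L a' a) α p' p        ≡⟨ cong (λ s → C s α p' p) (symmetric a' a) ⟩
    C (L a a') α p' p        ≡⟨ C-sym (L a a') α p p' ⟩
    C (L a a') α p p'        ≡⟨ N-block α a p a' p' ⟨
    N α (a , p) (a' , p')    ∎
    where open ≡-Reasoning

  N-01 : ∀ α i j → N α i j ≡ 0 ⊎ N α i j ≡ 1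
  N-01 α (a , p) (c , p') rewrite N-block α a p c p' = C-01 (L a c) α p p'

  latin-row-count : ∀ a s → ΣS (λ c → Idm _≟S_ (L a c) s) ≡ 1
  latin-row-count a s with row-unique a s
  ... | c₀ , L-a-c₀≡s , only-c₀ =
    trans (ΣS-delta c₀ _ (λ c c≢c₀ → Idm-≢ _≟S_ (c≢c₀ ∘ only-c₀ c)))
          (trans (cong (λ t → Idm _≟S_ t s) L-a-c₀≡s) (Idm-refl _≟S_ s))

  latin-reindex : ∀ a (g : S → ℕ) → ΣS (λ c → g (L a c)) ≡ ΣS g
  latin-reindex a g = begin
    ΣS (λ c → g (L a c))                                ≡⟨ sumL-cong elemsS (λ c → ΣS-pick (L a c) g) ⟨
    ΣS (λ c → ΣS (λ s → Idm _≟S_ (L a c) s * g s))      ≡⟨ sumL-swap elemsS elemsS (λ c s → Idm _≟S_ (L a c) s * g s) ⟩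
    ΣS (λ s → ΣS (λ c → Idm _≟S_ (L a c) s * g s))      ≡⟨ sumL-cong elemsS count ⟩
    ΣS g                                                ∎
    where
    open ≡-Reasoning
    count : ∀ s → ΣS (λ c → Idm _≟S_ (L a c) s * g s) ≡ g s
    count s = begin
      ΣS (λ c → Idm _≟S_ (L a c) s * g s)   ≡⟨ sumL-cong elemsS (λ c → *-comm _ (g s)) ⟩
      ΣS (λ c → g s * Idm _≟S_ (L a c) s)   ≡⟨ sumL-*ˡ elemsS (g s) _ ⟩
      g s * ΣS (λ c → Idm _≟S_ (L a c) s)   ≡⟨ cong (g s *_) (latin-row-count a s) ⟩
      g s * 1                               ≡⟨ *-identityʳ (g s) ⟩
      g s                                   ∎

  L-≢x : ∀ {a c} → a ≢ c → L a c ≢ x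
  L-≢x {a} {c} a≢c L-a-c≡x with col-unique c x
  ... | _ , _ , only = a≢c (trans (only a L-a-c≡x) (sym (only c (diagonal c))))

  L-distinct : ∀ {a a'} c → a ≢ a' → L a c ≢ L c a'
  L-distinct {a} {a'} c a≢a' L-a-c≡L-c-a' with col-unique c (L a c)
  ... | _ , _ , only = a≢a' (trans (only a refl) (sym (only a' (trans (symmetric a' c) (sym L-a-c≡L-c-a')))))

  module BlockProduct (α β β₁ γ₁ β₂ γ₂ : F) where

    blockProd : S → S → ℕ
    blockProd s t = ΣF (λ b → ΣF (λ g → C s α (β₁ , γ₁) (b , g) * C t β (b , g) (β₂ , γ₂)))

    C-el-col : ∀ v b g → C (el v) β (b , g) (β₂ , γ₂) ≡ δ₀ (g +F (γ₂ +F (v *F (β₂ +F b) +F β)))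
    C-el-col v b g = trans (C-sym (el v) β (β₂ , γ₂) (b , g)) (C-el-row v β β₂ γ₂ b g)

    C-y-col : ∀ b g → C y β (b , g) (β₂ , γ₂) ≡ δ₀ (b +F (β₂ +F β))
    C-y-col b g = trans (C-sym y β (β₂ , γ₂) (b , g)) (C-y-row β β₂ γ₂ b g)

    blockProd-xˡ : ∀ t → blockProd x t ≡ 0
    blockProd-xˡ t = ΣF-zero (λ _ → ΣF-zero (λ _ → refl))

    blockProd-xʳ : ∀ s → blockProd s x ≡ 0
    blockProd-xʳ s = ΣF-zero (λ b → ΣF-zero (λ g → *-zeroʳ (C s α (β₁ , γ₁) (b , g))))

    K : F → F → F
    K u v = γ₁ +F γ₂ +F u *F β₁ +F v *F β₂ +F α +F β

    blockProd-el-el : ∀ u v → blockProd (el u) (el v) ≡ ΣF (λ b → δ₀ ((u +F v) *F b +F K u v))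
    blockProd-el-el u v = sumL-cong elems (λ b → begin
      ΣF (λ g → C (el u) α (β₁ , γ₁) (b , g) * C (el v) β (b , g) (β₂ , γ₂))
        ≡⟨ sumL-cong elems (λ g → cong₂ _*_ (C-el-row u α β₁ γ₁ b g) (C-el-col v b g)) ⟩
      ΣF (λ g → δ₀ (g +F A b) * δ₀ (g +F B b))   ≡⟨ ΣF-δ₀-pick (A b) (λ g → δ₀ (g +F B b)) ⟩
      δ₀ (A b +F B b)                             ≡⟨ cong δ₀ (collect γ₁ γ₂ u v β₁ β₂ b α β) ⟩
      δ₀ ((u +F v) *F b +F K u v)                 ∎)
      where
      open ≡-Reasoning
      A B : F → F
      A b = γ₁ +F (u *F (β₁ +F b) +F α)
      B b = γ₂ +F (v *F (β₂ +F b) +F β)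
      collect : ∀ γ₁ γ₂ u v β₁ β₂ b α β →
        γ₁ +F (u *F (β₁ +F b) +F α) +F (γ₂ +F (v *F (β₂ +F b) +F β))
          ≡ (u +F v) *F b +F (γ₁ +F γ₂ +F u *F β₁ +F v *F β₂ +F α +F β)
      collect = solve 9 (λ γ₁ γ₂ u v β₁ β₂ b α β →
        (γ₁ :+ (u :* (β₁ :+ b) :+ α) :+ (γ₂ :+ (v :* (β₂ :+ b) :+ β)))
          ⊜ ((u :+ v) :* b :+ (γ₁ :+ γ₂ :+ u :* β₁ :+ v :* β₂ :+ α :+ β))) refl

    blockProd-el-≢ : ∀ {u v} → u ≢ v → blockProd (el u) (el v) ≡ 1
    blockProd-el-≢ {u} {v} u≢v = trans (blockProd-el-el u v) (ΣF-δ₀-linear (u≢v ∘ +≡0⇒≡) (K u v))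

    K′ : F
    K′ = γ₁ +F γ₂ +F (α +F β)

    blockProd-el-diag : ∀ u → blockProd (el u) (el u) ≡ q * δ₀ ((β₁ +F β₂) *F u +F K′)
    blockProd-el-diag u = begin
      blockProd (el u) (el u)                        ≡⟨ blockProd-el-el u u ⟩
      ΣF (λ b → δ₀ ((u +F u) *F b +F K u u))         ≡⟨ sumL-cong elems (λ b → cong δ₀ (u-free b)) ⟩
      ΣF (λ _ → δ₀ ((β₁ +F β₂) *F u +F K′))          ≡⟨ ΣF-const _ ⟩
      q * δ₀ ((β₁ +F β₂) *F u +F K′)                 ∎
      where
      open ≡-Reasoning
      regroup : ∀ γ₁ γ₂ u β₁ β₂ α β →
        γ₁ +F γ₂ +F u *F β₁ +F u *F β₂ +F α +F β ≡ (β₁ +F β₂) *F u +F (γ₁ +F γ₂ +F (α +F β))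
      regroup = solve 7 (λ γ₁ γ₂ u β₁ β₂ α β →
        (γ₁ :+ γ₂ :+ u :* β₁ :+ u :* β₂ :+ α :+ β) ⊜ ((β₁ :+ β₂) :* u :+ (γ₁ :+ γ₂ :+ (α :+ β)))) refl
      u-free : ∀ b → (u +F u) *F b +F K u u ≡ (β₁ +F β₂) *F u +F K′
      u-free b = begin
        (u +F u) *F b +F K u u    ≡⟨ cong (λ z → z *F b +F K u u) (x+x≡0 u) ⟩
        0# *F b +F K u u          ≡⟨ cong (_+F K u u) (R.zeroˡ b) ⟩
        0# +F K u u               ≡⟨ R.+-identityˡ (K u u) ⟩
        K u u                     ≡⟨ regroup γ₁ γ₂ u β₁ β₂ α β ⟩
        (β₁ +F β₂) *F u +F K′     ∎

    blockProd-el-y : ∀ u → blockProd (el u) y ≡ 1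
    blockProd-el-y u = trans (sumL-cong elems inner) (ΣF-δ₀ (β₂ +F β))
      where
      inner : ∀ b → ΣF (λ g → C (el u) α (β₁ , γ₁) (b , g) * C y β (b , g) (β₂ , γ₂)) ≡ δ₀ (b +F (β₂ +F β))
      inner b = trans (sumL-cong elems (λ g → cong₂ _*_ (C-el-row u α β₁ γ₁ b g) (C-y-col b g)))
                      (ΣF-δ₀-pick _ (λ _ → δ₀ (b +F (β₂ +F β))))

    blockProd-y-el : ∀ v → blockProd y (el v) ≡ 1
    blockProd-y-el v = trans (sumL-cong elems inner) (ΣF-δ₀ (β₁ +F α))
      where
      inner : ∀ b → ΣF (λ g → C y α (β₁ , γ₁) (b , g) * C (el v) β (b , g) (β₂ , γ₂)) ≡ δ₀ (b +F (β₁ +F α))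
      inner b = begin
        ΣF (λ g → C y α (β₁ , γ₁) (b , g) * C (el v) β (b , g) (β₂ , γ₂))
          ≡⟨ sumL-cong elems (λ g → cong₂ _*_ (C-y-row α β₁ γ₁ b g) (C-el-col v b g)) ⟩
        ΣF (λ g → δ₀ (b +F (β₁ +F α)) * δ₀ (g +F (γ₂ +F (v *F (β₂ +F b) +F β))))
          ≡⟨ sumL-*ˡ elems (δ₀ (b +F (β₁ +F α))) (λ g → δ₀ (g +F (γ₂ +F (v *F (β₂ +F b) +F β)))) ⟩
        δ₀ (b +F (β₁ +F α)) * ΣF (λ g → δ₀ (g +F (γ₂ +F (v *F (β₂ +F b) +F β))))
          ≡⟨ cong (δ₀ (b +F (β₁ +F α)) *_) (ΣF-δ₀ _) ⟩
        δ₀ (b +F (β₁ +F α)) * 1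
          ≡⟨ *-identityʳ _ ⟩
        δ₀ (b +F (β₁ +F α)) ∎
        where open ≡-Reasoning

    blockProd-y-y : blockProd y y ≡ q * δ₀ (β₁ +F β₂ +F (α +F β))
    blockProd-y-y = begin
      blockProd y y
        ≡⟨ sumL-cong elems (λ b → trans (sumL-cong elems (λ g → cong₂ _*_ (C-y-row α β₁ γ₁ b g) (C-y-col b g)))
                                         (ΣF-const _)) ⟩
      ΣF (λ b → q * (δ₀ (b +F (β₁ +F α)) * δ₀ (b +F (β₂ +F β))))
        ≡⟨ sumL-*ˡ elems q _ ⟩
      q * ΣF (λ b → δ₀ (b +F (β₁ +F α)) * δ₀ (b +F (β₂ +F β)))
        ≡⟨ cong (q *_) (ΣF-δ₀-pick (β₁ +F α) (λ b → δ₀ (b +F (β₂ +F β)))) ⟩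
      q * δ₀ (β₁ +F α +F (β₂ +F β))
        ≡⟨ cong (λ z → q * δ₀ z) (regroup β₁ α β₂ β) ⟩
      q * δ₀ (β₁ +F β₂ +F (α +F β)) ∎
      where
      open ≡-Reasoning
      regroup : ∀ β₁ α β₂ β → β₁ +F α +F (β₂ +F β) ≡ β₁ +F β₂ +F (α +F β)
      regroup = solve 4 (λ β₁ α β₂ β → (β₁ :+ α :+ (β₂ :+ β)) ⊜ (β₁ :+ β₂ :+ (α :+ β))) refl

    blockProd-distinct : ∀ {s t} → s ≢ x → t ≢ x → s ≢ t → blockProd s t ≡ 1
    blockProd-distinct {x}    {_}    s≢x _   _   = ⊥-elim (s≢x refl)
    blockProd-distinct {_}    {x}    _   t≢x _   = ⊥-elim (t≢x refl)
    blockProd-distinct {el u} {el v} _   _   s≢t = blockProd-el-≢ (s≢t ∘ cong el)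
    blockProd-distinct {el u} {y}    _   _   _   = blockProd-el-y u
    blockProd-distinct {y}    {el v} _   _   _   = blockProd-y-el v
    blockProd-distinct {y}    {y}    _   _   s≢t = ⊥-elim (s≢t refl)

    -- For c ∉ {a, a'} the blocks L(a,c) ≠ L(c,a') both differ from x and contribute 1;
    -- for c ∈ {a, a'} one of them is L(c,c) = x and the product vanishes.
    offdiagonal-term : ∀ {a a'} → a ≢ a' → ∀ c →
                       Idm _≟S_ a c + Idm _≟S_ a' c + blockProd (L a c) (L c a') ≡ 1
    offdiagonal-term {a} {a'} a≢a' c with c ≟S a | c ≟S a'
    ... | yes refl | _
      rewrite diagonal c | blockProd-xˡ (L c a') | Idm-refl _≟S_ c | Idm-≢ _≟S_ (a≢a' ∘ sym) = refl
    ... | no c≢a | yes refl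
      rewrite diagonal c | blockProd-xʳ (L a c) | Idm-refl _≟S_ c | Idm-≢ _≟S_ a≢a' = refl
    ... | no c≢a | no c≢a'
      rewrite Idm-≢ _≟S_ (c≢a ∘ sym) | Idm-≢ _≟S_ (c≢a' ∘ sym) =
        blockProd-distinct (L-≢x (c≢a ∘ sym)) (L-≢x c≢a') (L-distinct c a≢a')

    offdiagonal-sum : ∀ {a a'} → a ≢ a' → ΣS (λ c → blockProd (L a c) (L c a')) ≡ q
    offdiagonal-sum {a} {a'} a≢a' = +-cancelˡ-≡ 2 _ _ (begin
      2 + ΣS f                                       ≡⟨ cong₂ (λ i j → i + j + ΣS f) (ΣS-Idm a) (ΣS-Idm a') ⟨
      ΣS (Idm _≟S_ a) + ΣS (Idm _≟S_ a') + ΣS f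
        ≡⟨ trans (sumL-+ elemsS (λ c → Idm _≟S_ a c + Idm _≟S_ a' c) f) (cong (_+ ΣS f) (sumL-+ elemsS (Idm _≟S_ a) (Idm _≟S_ a'))) ⟨
      ΣS (λ c → Idm _≟S_ a c + Idm _≟S_ a' c + f c)  ≡⟨ sumL-cong elemsS (offdiagonal-term a≢a') ⟩
      ΣS (λ _ → 1)                                   ≡⟨ sumL-const elemsS 1 ⟩
      length elemsS * 1                              ≡⟨ *-identityʳ _ ⟩
      length elemsS                                  ≡⟨ length-elemsS ⟩
      2 + q                                          ∎)
      where
      open ≡-Reasoning
      f : S → ℕ
      f c = blockProd (L a c) (L c a')

    diagonal-sum : ∀ a → ΣS (λ c → blockProd (L a c) (L c a))
                           ≡ q * δ₀ (β₁ +F β₂ +F (α +F β)) + q * ΣF (λ u → δ₀ ((β₁ +F β₂) *F u +F K′))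
    diagonal-sum a = begin
      ΣS (λ c → blockProd (L a c) (L c a))   ≡⟨ sumL-cong elemsS (λ c → cong (blockProd (L a c)) (symmetric c a)) ⟩
      ΣS (λ c → blockProd (L a c) (L a c))   ≡⟨ latin-reindex a (λ s → blockProd s s) ⟩
      ΣS (λ s → blockProd s s)
        ≡⟨ cong₂ _+_ (blockProd-xˡ x)
                     (cong₂ _+_ blockProd-y-y (trans (sumL-map elems el (λ s → blockProd s s))
                                                     (trans (sumL-cong elems blockProd-el-diag) (sumL-*ˡ elems q _)))) ⟩
      q * δ₀ (β₁ +F β₂ +F (α +F β)) + q * ΣF (λ u → δ₀ ((β₁ +F β₂) *F u +F K′)) ∎
      where open ≡-Reasoning

  productFormula : F → Mat (S × (F × F))
  productFormula γ = ((q ^ 2) · reassoc (Idm _≟SF_ ⊗ φ γ))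
                   ⊕ (q · (Idm _≟S_ ⊗ φ γ ⊗ Jm))
                   ⊕ (q · reassoc ((Jm ⊖ Idm _≟SF_) ⊗ Jm))

  module _ (α β β₁ γ₁ β₂ γ₂ : F) where
    open BlockProduct α β β₁ γ₁ β₂ γ₂
    open ≡-Reasoning

    product-blocks : ∀ a a' → mul elemsSFF (N α) (N β) (a , β₁ , γ₁) (a' , β₂ , γ₂)
                              ≡ ΣS (λ c → blockProd (L a c) (L c a'))
    product-blocks a a' =
      trans (ΣSFF _) (sumL-cong elemsS (λ c → sumL-cong elems (λ b → sumL-cong elems (λ g →
        cong₂ _*_ (N-block α a (β₁ , γ₁) c (b , g)) (N-block β c (b , g) a' (β₂ , γ₂))))))

    offdiagonal-entry : ∀ {a a'} → a ≢ a' → mul elemsSFF (N α) (N β) (a , β₁ , γ₁) (a' , β₂ , γ₂)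
                                            ≡ productFormula (α +F β) (a , β₁ , γ₁) (a' , β₂ , γ₂)
    offdiagonal-entry {a} {a'} a≢a' = begin
      mul elemsSFF (N α) (N β) (a , β₁ , γ₁) (a' , β₂ , γ₂)  ≡⟨ product-blocks a a' ⟩
      ΣS (λ c → blockProd (L a c) (L c a'))                  ≡⟨ offdiagonal-sum a≢a' ⟩
      q                                                      ≡⟨ arithmetic q ⟨
      q ^ 2 * (0 * φ (α +F β) γ₁ γ₂) + q * (0 * (φ (α +F β) β₁ β₂ * 1)) + q * ((1 ∸ 0) * 1)
        ≡⟨ cong₂ (λ i j → q ^ 2 * (i * φ (α +F β) γ₁ γ₂) + q * (j * (φ (α +F β) β₁ β₂ * 1)) + q * ((1 ∸ i) * 1))
                 (Idm-≢ _≟SF_ (a≢a' ∘ cong proj₁)) (Idm-≢ _≟S_ a≢a') ⟨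
      productFormula (α +F β) (a , β₁ , γ₁) (a' , β₂ , γ₂)  ∎
      where
      arithmetic : ∀ n → n ^ 2 * 0 + n * 0 + n * 1 ≡ n
      arithmetic n = trans (cong₂ (λ u v → u + v + n * 1) (*-zeroʳ (n ^ 2)) (*-zeroʳ n)) (*-identityʳ n)

    -- The Σ_u term counts the roots u of (β₁ + β₂) u + K′: exactly one unless β₁ = β₂,
    -- and then q or none.
    diagonal-root-count : Dec (β₁ ≡ β₂) →
      q * φ (α +F β) β₁ β₂ + q * ΣF (λ u → δ₀ ((β₁ +F β₂) *F u +F K′))
        ≡ q ^ 2 * (Idm _≟_ β₁ β₂ * φ (α +F β) γ₁ γ₂) + q * (1 * (φ (α +F β) β₁ β₂ * 1)) + q * ((1 ∸ Idm _≟_ β₁ β₂) * 1)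
    diagonal-root-count (yes β₁≡β₂) = begin
      q * φ (α +F β) β₁ β₂ + q * ΣF (λ u → δ₀ ((β₁ +F β₂) *F u +F K′))
        ≡⟨ cong (λ t → q * φ (α +F β) β₁ β₂ + q * t) q-roots ⟩
      q * φ (α +F β) β₁ β₂ + q * (q * φ (α +F β) γ₁ γ₂)
        ≡⟨ product-diagonal-equal q _ _ ⟩
      q ^ 2 * (1 * φ (α +F β) γ₁ γ₂) + q * (1 * (φ (α +F β) β₁ β₂ * 1)) + q * ((1 ∸ 1) * 1)
        ≡⟨ cong (λ i → q ^ 2 * (i * φ (α +F β) γ₁ γ₂) + q * (1 * (φ (α +F β) β₁ β₂ * 1)) + q * ((1 ∸ i) * 1))
                (trans (cong (Idm _≟_ β₁) (sym β₁≡β₂)) (Idm-refl _≟_ β₁)) ⟨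
      q ^ 2 * (Idm _≟_ β₁ β₂ * φ (α +F β) γ₁ γ₂) + q * (1 * (φ (α +F β) β₁ β₂ * 1)) + q * ((1 ∸ Idm _≟_ β₁ β₂) * 1) ∎
      where
      constant : ∀ u → (β₁ +F β₂) *F u +F K′ ≡ K′
      constant u = trans (cong (λ z → z *F u +F K′) (trans (cong (β₁ +F_) (sym β₁≡β₂)) (x+x≡0 β₁)))
                         (trans (cong (_+F K′) (R.zeroˡ u)) (R.+-identityˡ K′))
      q-roots : ΣF (λ u → δ₀ ((β₁ +F β₂) *F u +F K′)) ≡ q * φ (α +F β) γ₁ γ₂
      q-roots = trans (sumL-cong elems (λ u → cong δ₀ (constant u)))
                      (trans (ΣF-const (δ₀ K′)) (cong (q *_) (sym (φ-δ₀ (α +F β) γ₁ γ₂))))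
    diagonal-root-count (no β₁≢β₂) = begin
      q * φ (α +F β) β₁ β₂ + q * ΣF (λ u → δ₀ ((β₁ +F β₂) *F u +F K′))
        ≡⟨ cong (λ t → q * φ (α +F β) β₁ β₂ + q * t) (ΣF-δ₀-linear (β₁≢β₂ ∘ +≡0⇒≡) K′) ⟩
      q * φ (α +F β) β₁ β₂ + q * 1
        ≡⟨ product-diagonal-distinct q _ (φ (α +F β) γ₁ γ₂) ⟩
      q ^ 2 * (0 * φ (α +F β) γ₁ γ₂) + q * (1 * (φ (α +F β) β₁ β₂ * 1)) + q * ((1 ∸ 0) * 1)
        ≡⟨ cong (λ i → q ^ 2 * (i * φ (α +F β) γ₁ γ₂) + q * (1 * (φ (α +F β) β₁ β₂ * 1)) + q * ((1 ∸ i) * 1))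
                (Idm-≢ _≟_ β₁≢β₂) ⟨
      q ^ 2 * (Idm _≟_ β₁ β₂ * φ (α +F β) γ₁ γ₂) + q * (1 * (φ (α +F β) β₁ β₂ * 1)) + q * ((1 ∸ Idm _≟_ β₁ β₂) * 1) ∎

    diagonal-entry : ∀ a → mul elemsSFF (N α) (N β) (a , β₁ , γ₁) (a , β₂ , γ₂)
                           ≡ productFormula (α +F β) (a , β₁ , γ₁) (a , β₂ , γ₂)
    diagonal-entry a = begin
      mul elemsSFF (N α) (N β) (a , β₁ , γ₁) (a , β₂ , γ₂)
        ≡⟨ trans (product-blocks a a) (diagonal-sum a) ⟩
      q * δ₀ (β₁ +F β₂ +F (α +F β)) + q * ΣF (λ u → δ₀ ((β₁ +F β₂) *F u +F K′))
        ≡⟨ cong (λ t → q * t + q * ΣF (λ u → δ₀ ((β₁ +F β₂) *F u +F K′))) (φ-δ₀ (α +F β) β₁ β₂) ⟨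
      q * φ (α +F β) β₁ β₂ + q * ΣF (λ u → δ₀ ((β₁ +F β₂) *F u +F K′))
        ≡⟨ diagonal-root-count (β₁ ≟ β₂) ⟩
      q ^ 2 * (Idm _≟_ β₁ β₂ * φ (α +F β) γ₁ γ₂) + q * (1 * (φ (α +F β) β₁ β₂ * 1)) + q * ((1 ∸ Idm _≟_ β₁ β₂) * 1)
        ≡⟨ cong₂ (λ i j → q ^ 2 * (i * φ (α +F β) γ₁ γ₂) + q * (j * (φ (α +F β) β₁ β₂ * 1)) + q * ((1 ∸ i) * 1))
                 Idm-SF (Idm-refl _≟S_ a) ⟨
      productFormula (α +F β) (a , β₁ , γ₁) (a , β₂ , γ₂) ∎
      where
      Idm-SF : Idm _≟SF_ (a , β₁) (a , β₂) ≡ Idm _≟_ β₁ β₂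
      Idm-SF = trans (Idm-pair _≟S_ _≟_ a a β₁ β₂) (trans (cong (_* Idm _≟_ β₁ β₂) (Idm-refl _≟S_ a)) (*-identityˡ _))

  product-entry : ∀ α β → mul elemsSFF (N α) (N β) ≐ productFormula (α +F β)
  product-entry α β (a , β₁ , γ₁) (a' , β₂ , γ₂) = by-cases (a ≟S a')
    where
    by-cases : Dec (a ≡ a') → mul elemsSFF (N α) (N β) (a , β₁ , γ₁) (a' , β₂ , γ₂)
                              ≡ productFormula (α +F β) (a , β₁ , γ₁) (a' , β₂ , γ₂)
    by-cases (yes refl)  = diagonal-entry α β β₁ γ₁ β₂ γ₂ a
    by-cases (no  a≢a') = offdiagonal-entry α β β₁ γ₁ β₂ γ₂ a≢a'

  square-entry : ∀ α → mul elemsSFF (N α) (N α) ≐ ((q ^ 2) · Idm _≟SFF_) ⊕ (q · Jm)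
  square-entry α (a , β₁ , γ₁) (a' , β₂ , γ₂) = begin
    mul elemsSFF (N α) (N α) (a , β₁ , γ₁) (a' , β₂ , γ₂)
      ≡⟨ product-entry α α (a , β₁ , γ₁) (a' , β₂ , γ₂) ⟩
    q ^ 2 * (I * φ (α +F α) γ₁ γ₂) + q * (Idm _≟S_ a a' * (φ (α +F α) β₁ β₂ * 1)) + q * ((1 ∸ I) * 1)
      ≡⟨ cong₂ (λ u v → q ^ 2 * (I * u) + q * v + q * ((1 ∸ I) * 1)) (φ-double α γ₁ γ₂) I-S⊗F ⟩
    q ^ 2 * (I * Idm _≟_ γ₁ γ₂) + q * I + q * ((1 ∸ I) * 1)
      ≡⟨ +-assoc (q ^ 2 * (I * Idm _≟_ γ₁ γ₂)) (q * I) (q * ((1 ∸ I) * 1)) ⟩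
    q ^ 2 * (I * Idm _≟_ γ₁ γ₂) + (q * I + q * ((1 ∸ I) * 1))
      ≡⟨ cong₂ _+_ (cong (q ^ 2 *_) I-SF⊗F)
                   (trans (cong (λ t → q * I + q * t) (*-identityʳ (1 ∸ I))) (*-complement q (Idm-≤1 _≟SF_ _ _))) ⟩
    q ^ 2 * Idm _≟SFF_ (a , β₁ , γ₁) (a' , β₂ , γ₂) + q * 1 ∎
    where
    open ≡-Reasoning
    I : ℕ
    I = Idm _≟SF_ (a , β₁) (a' , β₂)
    I-S⊗F : Idm _≟S_ a a' * (φ (α +F α) β₁ β₂ * 1) ≡ I
    I-S⊗F = trans (cong (Idm _≟S_ a a' *_) (trans (*-identityʳ _) (φ-double α β₁ β₂)))
                  (sym (Idm-pair _≟S_ _≟_ a a' β₁ β₂))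
    I-SF⊗F : I * Idm _≟_ γ₁ γ₂ ≡ Idm _≟SFF_ (a , β₁ , γ₁) (a' , β₂ , γ₂)
    I-SF⊗F = begin
      I * Idm _≟_ γ₁ γ₂                                    ≡⟨ cong (_* Idm _≟_ γ₁ γ₂) (Idm-pair _≟S_ _≟_ a a' β₁ β₂) ⟩
      Idm _≟S_ a a' * Idm _≟_ β₁ β₂ * Idm _≟_ γ₁ γ₂        ≡⟨ *-assoc (Idm _≟S_ a a') _ _ ⟩
      Idm _≟S_ a a' * (Idm _≟_ β₁ β₂ * Idm _≟_ γ₁ γ₂)      ≡⟨ cong (Idm _≟S_ a a' *_) (Idm-pair _≟_ _≟_ β₁ β₂ γ₁ γ₂) ⟨
      Idm _≟S_ a a' * Idm _≟F²_ (β₁ , γ₁) (β₂ , γ₂)        ≡⟨ Idm-pair _≟S_ _≟F²_ a a' (β₁ , γ₁) (β₂ , γ₂) ⟨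
      Idm _≟SFF_ (a , β₁ , γ₁) (a' , β₂ , γ₂)              ∎

  C-row-sum : ∀ s α p → s ≢ x → ΣF (λ b → ΣF (λ g → C s α p (b , g))) ≡ q
  C-row-sum x      α p       x≢x = ⊥-elim (x≢x refl)
  C-row-sum y      α (β , γ) _   = begin
    ΣF (λ b → ΣF (λ g → C y α (β , γ) (b , g)))
      ≡⟨ sumL-cong elems (λ b → trans (sumL-cong elems (C-y-row α β γ b)) (ΣF-const _)) ⟩
    ΣF (λ b → q * δ₀ (b +F (β +F α)))   ≡⟨ sumL-*ˡ elems q _ ⟩
    q * ΣF (λ b → δ₀ (b +F (β +F α)))   ≡⟨ cong (q *_) (ΣF-δ₀ (β +F α)) ⟩
    q * 1                               ≡⟨ *-identityʳ q ⟩
    q                                   ∎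
    where open ≡-Reasoning
  C-row-sum (el u) α (β , γ) _   =
    trans (sumL-cong elems (λ b → trans (sumL-cong elems (C-el-row u α β γ b)) (ΣF-δ₀ _)))
          (trans (ΣF-const 1) (*-identityʳ q))

  N-row-sum : ∀ α i → sumL elemsSFF (N α i) ≡ q ^ 2 + q
  N-row-sum α (a , p) = begin
    sumL elemsSFF (N α (a , p))                                ≡⟨ ΣSFF _ ⟩
    ΣS (λ c → ΣF (λ b → ΣF (λ g → N α (a , p) (c , b , g))))
      ≡⟨ sumL-cong elemsS (λ c → sumL-cong elems (λ b → sumL-cong elems (λ g → N-block α a p c (b , g)))) ⟩
    ΣS (λ c → row (L a c))                                     ≡⟨ latin-reindex a row ⟩
    row x + (row y + sumL (map el elems) row)
      ≡⟨ cong₂ _+_ (ΣF-zero (λ _ → ΣF-zero (λ _ → refl)))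
                   (cong₂ _+_ (C-row-sum y α p (λ ()))
                              (trans (sumL-map elems el row)
                                     (trans (sumL-cong elems (λ u → C-row-sum (el u) α p (λ ()))) (ΣF-const q)))) ⟩
    q + q * q                                                  ≡⟨ +-comm q (q * q) ⟩
    q * q + q                                                  ≡⟨ cong (λ t → q * t + q) (*-identityʳ q) ⟨
    q ^ 2 + q                                                  ∎
    where
    open ≡-Reasoning
    row : S → ℕ
    row s = ΣF (λ b → ΣF (λ g → C s α p (b , g)))

  N-isSymmetricDesign : ∀ α → IsSymmetricDesign elemsSFF _≟SFF_ ((q + 2) * q ^ 2) (q ^ 2 + q) q (N α)
  N-isSymmetricDesign α = length-elemsSFF , N-01 α , N-row-sum α , N-Nᵀ
    where
    N-Nᵀ : mul elemsSFF (N α) (transpose (N α)) ≐ ((q ^ 2 + q ∸ q) · Idm _≟SFF_) ⊕ (q · Jm)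
    N-Nᵀ i j = begin
      sumL elemsSFF (λ k → N α i k * N α j k)   ≡⟨ sumL-cong elemsSFF (λ k → cong (N α i k *_) (N-symmetric α k j)) ⟩
      mul elemsSFF (N α) (N α) i j              ≡⟨ square-entry α i j ⟩
      q ^ 2 * Idm _≟SFF_ i j + q * 1            ≡⟨ cong (λ c → c * Idm _≟SFF_ i j + q * 1) (m+n∸n≡m (q ^ 2) q) ⟨
      (q ^ 2 + q ∸ q) * Idm _≟SFF_ i j + q * 1  ∎
      where open ≡-Reasoning

theorem3p2 : (m : ℕ) → m ≥ 1 → (𝔽 : FiniteField m) → (Lat : SymLatin (FiniteField.F 𝔽)) →
  let open Construction 𝔽 Lat
      open FiniteField 𝔽 using (F) renaming (_+_ to _+F_)
  in
  (∀ α → transpose (N α) ≐ N α)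
  × (∀ α β → mul elemsSFF (N α) (N β)
       ≐ ((q ^ 2) · reassoc (Idm _≟SF_ ⊗ φ (α +F β)))
         ⊕ (q · (Idm _≟S_ ⊗ φ (α +F β) ⊗ Jm))
         ⊕ (q · reassoc ((Jm ⊖ Idm _≟SF_) ⊗ Jm)))
  × (∀ α → mul elemsSFF (N α) (N α) ≐ ((q ^ 2) · Idm _≟SFF_) ⊕ (q · Jm))
  × (∀ α → IsSymmetricDesign elemsSFF _≟SFF_ ((q + 2) * q ^ 2) (q ^ 2 + q) q (N α))
theorem3p2 m m≥1 𝔽 Lat = N-symmetric , product-entry , square-entry , N-isSymmetricDesign
  where open Design m≥1 𝔽 Lat
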